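{- Let $m \geq 3$ and $n \geq 3$. The fixed-support Wasserstein barycenter linear program, in the form $A\,(\mathrm{vec}(X_1);\dots;\mathrm{vec}(X_m)) = ((-1)^1u_1;\dots;(-1)^m u_m;\mathbf{0}_n;\dots;\mathbf{0}_n)$, $X_k\ge 0$, with constraint matrix $A$ as described in the context, is not a minimum-cost flow problem; in particular its constraint matrix $A$ is not totally unimodular.
   Context: Fixed-support Wasserstein barycenter problem: given $u_1,\dots,u_m\in\Delta^n=\{v\in\mathbb{R}^n_+:\mathbf{1}_n^\top v=1\}$ and nonnegative cost matrices $C_1,\dots,C_m\in\mathbb{R}_+^{n\times n}$, minimize $\sum_{k=1}^m\langle C_k,X_k\rangle$ over $X_1,\dots,X_m\in\mathbb{R}_+^{n\times n}$ subject to $X_k\mathbf{1}_n=u_k$ ($k\in[m]$) and $X_{k+1}^\top\mathbf{1}_n=X_k^\top\mathbf{1}_n$ ($k\in[m-1]$). With row-major vectorization $\mathrm{vec}(X)\in\mathbb{R}^{n^2}$, $E=I_n\otimes\mathbf{1}_n^\top$ and $G=\mathbf{1}_n^\top\otimes I_n$ (both $n\times n^2$), the constraint matrix $A\in\mathbb{R}^{(2m-1)n\times mn^2}$ has $2m-1$ block rows and $m$ block columns of width $n^2$: for $k=1,\dots,m$, block row $k$ has $(-1)^kE$ in block column $k$ and zeros elsewhere; for $k=1,\dots,m-1$, block row $m+k$ has $(-1)^{k+1}G$ in block column $k$, $(-1)^kG$ in block column $k+1$, zeros elsewhere. A minimum-cost flow problem is a linear program $\min c^\top x$ s.t. $Mx=b$,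 $l\le x\le u$, where $M$ is the node–arc incidence matrix of a directed graph (each column has exactly one $+1$ and one $-1$); such constraint matrices are totally unimodular. A matrix is totally unimodular if every square submatrix has determinant in $\{ -1,0,1\}$. -}

module Defs where

open import Data.Nat using (ℕ; zero; suc; _∸_; _≡ᵇ_; _<ᵇ_) renaming (_+_ to _+ℕ_; _*_ to _*ℕ_)
open import Data.Integer using (ℤ; +_; -_; _+_; _*_; 0ℤ; 1ℤ; -1ℤ)
open import Data.Fin using (Fin; zero; suc; toℕ; punchIn; remQuot; _<_)
open import Data.Product using (_×_; _,_; ∃; ∃-syntax; Σ)
open import Data.Bool using (if_then_else_)
open import Relation.Binary.PropositionalEquality using (_≡_; _≢_)
open import Data.Sum using (_⊎_)

Matrix : ℕ → ℕ → Set
Matrix r c = Fin r → Fin c → ℤ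

sumFin : ∀ {k} → (Fin k → ℤ) → ℤ
sumFin {zero}  f = 0ℤ
sumFin {suc k} f = f zero + sumFin (λ i → f (suc i))

sgn : ℕ → ℤ
sgn zero    = 1ℤ
sgn (suc j) = - sgn j

det : ∀ {k} → Matrix k k → ℤ
det {zero}  M = 1ℤ
det {suc k} M =
  sumFin (λ j → sgn (toℕ j) * (M zero j * det (λ a b → M (suc a) (punchIn j b))))

StrictlyIncreasing : ∀ {k r} → (Fin k → Fin r) → Set
StrictlyIncreasing f = ∀ i j → i < j → f i < f j

submatrix : ∀ {r c k} → Matrix r c → (Fin k → Fin r) → (Fin k → Fin c) → Matrix k k
submatrix M f g a b = M (f a) (g b)

TotallyUnimodular : ∀ {r c} → Matrix r c → Set
TotallyUnimodular {r} {c} M =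
  ∀ (k : ℕ) (f : Fin k → Fin r) (g : Fin k → Fin c) →
  StrictlyIncreasing f → StrictlyIncreasing g →
  (det (submatrix M f g) ≡ -1ℤ) ⊎ (det (submatrix M f g) ≡ 0ℤ) ⊎ (det (submatrix M f g) ≡ 1ℤ)

IsIncidenceMatrix : ∀ {r c} → Matrix r c → Set
IsIncidenceMatrix {r} {c} M =
  ∀ (j : Fin c) → ∃[ a ] ∃[ b ] (a ≢ b × M a j ≡ 1ℤ × M b j ≡ -1ℤ ×
     (∀ i → i ≢ a → i ≢ b → M i j ≡ 0ℤ))

δ : ∀ {n} → Fin n → Fin n → ℤ
δ i j = if toℕ i ≡ᵇ toℕ j then 1ℤ else 0ℤ

-- Row block r (0 ≤ r < 2m-1), row i inside block; column block c (0 ≤ c < m),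
-- column (p,q) inside block (row-major vec: position p*n+q holds X_{pq}).
-- E = I_n ⊗ 1ᵀ : E[i,(p,q)] = δ i p ;  G = 1ᵀ ⊗ I_n : G[i,(p,q)] = δ i q.
-- For r < m (paper's k = r+1): block (r, r) is (-1)^(r+1) E.
-- For r = m + k' (paper's k = k'+1, 0 ≤ k' ≤ m-2):
--   block (r, k') is (-1)^(k+1) G = (-1)^k' G, block (r, k'+1) is (-1)^k G.
Aentry : (m n : ℕ) → ℕ → Fin n → ℕ → Fin n → Fin n → ℤ
Aentry m n r i c p q =
  if r <ᵇ m
  then (if c ≡ᵇ r then sgn (suc r) * δ i p else 0ℤ)
  else (if c ≡ᵇ (r ∸ m) then sgn (r ∸ m) * δ i q
        else if c ≡ᵇ suc (r ∸ m) then sgn (suc (r ∸ m)) * δ i q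
        else 0ℤ)

barycenterA : (m n : ℕ) → Matrix ((m +ℕ (m ∸ 1)) *ℕ n) (m *ℕ (n *ℕ n))
barycenterA m n row col with remQuot {m +ℕ (m ∸ 1)} n row | remQuot {m} (n *ℕ n) col
... | (rb , i) | (cb , pq) with remQuot {n} n pq
... | (p , q) = Aentry m n (toℕ rb) i (toℕ cb) p q

-- Number blocks as in the paper and positions inside a block from 0. The rows E₁[1], E₂[1],
-- E₃[0], G₁[0], G₁[1], G₂[1], G₂[2] and the columns X₁[1,0], X₁[1,1], X₂[1,0], X₂[1,2],
-- X₂[2,1], X₃[0,1], X₃[0,2] of A span a 7 × 7 submatrix in which every row and every column has
-- exactly two nonzero entries, arranged along a 7-cycle. An odd cycle gives determinant ±2 (here
-- +2), so A is not totally unimodular. Independently, the column of X₂[0,0] has the entry -1 in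
-- both G₁ and G₂, which no column of an incidence matrix does.
module Submission where

open import Defs
open import Data.Nat using (ℕ; zero; suc; _≤_; z≤n; s≤s; _∸_; _<ᵇ_) renaming (_+_ to _+ℕ_; _*_ to _*ℕ_)
import Data.Nat.Properties as ℕ
open import Data.Integer using (ℤ; +_; _+_; _*_; -1ℤ)
open import Data.Fin using (Fin; zero; suc; #_; toℕ; punchIn; combine; remQuot; _↑ˡ_; _↑ʳ_; inject₁; _<_; _≟_)
open import Data.Fin.Patterns using (0F; 1F; 2F; 3F; 4F; 5F; 6F)
open import Data.Fin.Properties using (toℕ-↑ˡ; toℕ-↑ʳ; toℕ-combine; remQuot-combine; combine-monoˡ-<; <-trans; <⇒≢)
open import Data.Bool using (false)
open import Data.Product using (_×_; _,_)
open import Data.Sum using (_⊎_; inj₁; inj₂)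
open import Function using (_∘_)
open import Relation.Nullary using (¬_; yes; no)
open import Relation.Binary.PropositionalEquality using (_≡_; _≢_; refl; sym; trans; cong; cong₂; subst)

sumFin-cong : ∀ {k} {f g : Fin k → ℤ} → (∀ i → f i ≡ g i) → sumFin f ≡ sumFin g
sumFin-cong {zero}  f≗g = refl
sumFin-cong {suc k} f≗g = cong₂ _+_ (f≗g zero) (sumFin-cong (f≗g ∘ suc))

det-cong : ∀ {k} {M N : Matrix k k} → (∀ a b → M a b ≡ N a b) → det M ≡ det N
det-cong {zero}  M≗N = refl
det-cong {suc k} M≗N = sumFin-cong λ j →
  cong (sgn (toℕ j) *_) (cong₂ _*_ (M≗N zero j) (det-cong λ a b → M≗N (suc a) (punchIn j b)))

adjacent<⇒strictlyIncreasing : ∀ {k r} (f : Fin (suc k) → Fin r) →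
  (∀ i → f (inject₁ i) < f (suc i)) → StrictlyIncreasing f
adjacent<⇒strictlyIncreasing f step zero    (suc j) _         = head< f step j
  where
  head< : ∀ {k r} (f : Fin (suc k) → Fin r) → (∀ i → f (inject₁ i) < f (suc i)) →
          ∀ j → f zero < f (suc j)
  head< f step zero    = step zero
  head< {suc k} f step (suc j) = <-trans (step zero) (head< (f ∘ suc) (step ∘ suc) j)
adjacent<⇒strictlyIncreasing {suc k} f step (suc i) (suc j) (s≤s i<j) =
  adjacent<⇒strictlyIncreasing (f ∘ suc) (step ∘ suc) i j i<j

combine-monoʳ-< : ∀ {m n} (i : Fin m) {k l : Fin n} → k < l → combine i k < combine i l
combine-monoʳ-< {n = n} i {k} {l} k<l
  rewrite toℕ-combine i k | toℕ-combine i l = ℕ.+-monoʳ-< (n *ℕ toℕ i) k<l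

↑ʳ-monoʳ-< : ∀ {m} n {i j : Fin m} → i < j → n ↑ʳ i < n ↑ʳ j
↑ʳ-monoʳ-< zero    i<j = i<j
↑ʳ-monoʳ-< (suc n) i<j = s≤s (↑ʳ-monoʳ-< n i<j)

twice-1⇒¬IsIncidenceMatrix : ∀ {r c} (M : Matrix r c) (j : Fin c) (a a′ : Fin r) → a ≢ a′ →
  M a j ≡ -1ℤ → M a′ j ≡ -1ℤ → ¬ IsIncidenceMatrix M
twice-1⇒¬IsIncidenceMatrix M j a a′ a≢a′ Maj Ma′j inc
  with inc j
... | plus , minus , _ , M₊ , _ , others = a≢a′ (trans (is-minus a Maj) (sym (is-minus a′ Ma′j)))
  where
  ≢plus : ∀ i → M i j ≡ -1ℤ → i ≢ plus
  ≢plus i Mij refl with () ← trans (sym Mij) M₊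

  is-minus : ∀ i → M i j ≡ -1ℤ → i ≡ minus
  is-minus i Mij with i ≟ minus
  ... | yes i≡minus = i≡minus
  ... | no  i≢minus with () ← trans (sym Mij) (others i (≢plus i Mij) i≢minus)

det≡2⇒¬TotallyUnimodular : ∀ {r c k} (M : Matrix r c) (f : Fin k → Fin r) (g : Fin k → Fin c) →
  StrictlyIncreasing f → StrictlyIncreasing g → det (submatrix M f g) ≡ + 2 → ¬ TotallyUnimodular M
det≡2⇒¬TotallyUnimodular {k = k} M f g f↑ g↑ det≡2 tu with tu k f g f↑ g↑
... | inj₁ det≡-1        with () ← trans (sym det≡2) det≡-1
... | inj₂ (inj₁ det≡0) with () ← trans (sym det≡2) det≡0
... | inj₂ (inj₂ det≡1) with () ← trans (sym det≡2) det≡1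

m+n≮ᵇm : ∀ m n → (m +ℕ n <ᵇ m) ≡ false
m+n≮ᵇm zero    n = refl
m+n≮ᵇm (suc m) n = m+n≮ᵇm m n

module Barycenter (m n : ℕ) where

  Row : Set
  Row = (Fin m × Fin n) ⊎ (Fin (m ∸ 1) × Fin n)

  Column : Set
  Column = Fin m × Fin n × Fin n

  block : Row → Fin (m +ℕ (m ∸ 1))
  block (inj₁ (k , _)) = k ↑ˡ (m ∸ 1)
  block (inj₂ (k , _)) = m ↑ʳ k

  position : Row → Fin n
  position (inj₁ (_ , i)) = i
  position (inj₂ (_ , i)) = i

  row : Row → Fin ((m +ℕ (m ∸ 1)) *ℕ n)
  row r = combine (block r) (position r)

  column : Column → Fin (m *ℕ (n *ℕ n))
  column (k , p , q) = combine k (combine p q)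

  row-monoˡ-< : ∀ r r′ → block r < block r′ → row r < row r′
  row-monoˡ-< r r′ = combine-monoˡ-< (position r) (position r′)

  row-monoʳ-< : ∀ r r′ → block r ≡ block r′ → position r < position r′ → row r < row r′
  row-monoʳ-< r r′ same =
    subst (λ b → row r < combine b (position r′)) same ∘ combine-monoʳ-< (block r)

  column-monoˡ-< : ∀ c p q c′ p′ q′ → c < c′ → column (c , p , q) < column (c′ , p′ , q′)
  column-monoˡ-< c p q c′ p′ q′ = combine-monoˡ-< (combine p q) (combine p′ q′)

  column-monoᵐ-< : ∀ c p q p′ q′ → p < p′ → column (c , p , q) < column (c , p′ , q′)
  column-monoᵐ-< c p q p′ q′ = combine-monoʳ-< c ∘ combine-monoˡ-< q q′

  column-monoʳ-< : ∀ c p q q′ → q < q′ → column (c , p , q) < column (c , p , q′)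
  column-monoʳ-< c p q q′ = combine-monoʳ-< c ∘ combine-monoʳ-< p

  -- A G-row is read off with m = 0, which selects the G-part of Aentry (see Aentry-shift);
  -- unlike Aentry m n (m + k) this form still computes when m is a variable.
  entry : Row → Column → ℤ
  entry (inj₁ (k , i)) (c , p , q) = Aentry m n (toℕ k) i (toℕ c) p q
  entry (inj₂ (k , i)) (c , p , q) = Aentry 0 n (toℕ k) i (toℕ c) p q

  barycenterA-combine : ∀ (rb : Fin (m +ℕ (m ∸ 1))) i (cb : Fin m) p q →
    barycenterA m n (combine rb i) (combine cb (combine p q)) ≡ Aentry m n (toℕ rb) i (toℕ cb) p q
  barycenterA-combine rb i cb p q =
    trans (cong₂ (λ (rb , i) (cb , pq) → Aentry-at rb i cb (remQuot {n} n pq))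
                 (remQuot-combine rb i) (remQuot-combine cb (combine p q)))
          (cong (Aentry-at rb i cb) (remQuot-combine p q))
    where
    Aentry-at : Fin (m +ℕ (m ∸ 1)) → Fin n → Fin m → Fin n × Fin n → ℤ
    Aentry-at rb i cb (p , q) = Aentry m n (toℕ rb) i (toℕ cb) p q

  Aentry-shift : ∀ k i c p q → Aentry m n (m +ℕ k) i c p q ≡ Aentry 0 n k i c p q
  Aentry-shift k i c p q rewrite m+n≮ᵇm m k | ℕ.m+n∸m≡n m k = refl

  barycenterA-entry : ∀ r s → barycenterA m n (row r) (column s) ≡ entry r s
  barycenterA-entry (inj₁ (k , i)) (c , p , q)
    rewrite barycenterA-combine (k ↑ˡ (m ∸ 1)) i c p q | toℕ-↑ˡ k (m ∸ 1) = refl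
  barycenterA-entry (inj₂ (k , i)) (c , p , q)
    rewrite barycenterA-combine (m ↑ʳ k) i c p q | toℕ-↑ʳ m k = Aentry-shift (toℕ k) i (toℕ c) p q

module OddCycle (m′ n′ : ℕ) where

  m n : ℕ
  m = 3 +ℕ m′
  n = 3 +ℕ n′

  open Barycenter m n

  cycleRow : Fin 7 → Row
  cycleRow = λ where
    0F → inj₁ (# 0 , # 1)
    1F → inj₁ (# 1 , # 1)
    2F → inj₁ (# 2 , # 0)
    3F → inj₂ (# 0 , # 0)
    4F → inj₂ (# 0 , # 1)
    5F → inj₂ (# 1 , # 1)
    6F → inj₂ (# 1 , # 2)

  cycleColumn : Fin 7 → Column
  cycleColumn = λ where
    0F → # 0 , # 1 , # 0
    1F → # 0 , # 1 , # 1
    2F → # 1 , # 1 , # 0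
    3F → # 1 , # 1 , # 2
    4F → # 1 , # 2 , # 1
    5F → # 2 , # 0 , # 1
    6F → # 2 , # 0 , # 2

  cycleEntries : Matrix 7 7
  cycleEntries a b = entry (cycleRow a) (cycleColumn b)

  det-cycle : det cycleEntries ≡ + 2
  det-cycle = refl

  cycleRow-step : ∀ i → row (cycleRow (inject₁ i)) < row (cycleRow (suc i))
  cycleRow-step = λ where
    0F → row-monoˡ-< (cycleRow 0F) (cycleRow 1F) (s≤s z≤n)
    1F → row-monoˡ-< (cycleRow 1F) (cycleRow 2F) (s≤s (s≤s z≤n))
    2F → row-monoˡ-< (cycleRow 2F) (cycleRow 3F) (s≤s (s≤s (s≤s z≤n)))
    3F → row-monoʳ-< (cycleRow 3F) (cycleRow 4F) refl (s≤s z≤n)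
    4F → row-monoˡ-< (cycleRow 4F) (cycleRow 5F) (↑ʳ-monoʳ-< m (s≤s z≤n))
    5F → row-monoʳ-< (cycleRow 5F) (cycleRow 6F) refl (s≤s (s≤s z≤n))

  cycleColumn-step : ∀ i → column (cycleColumn (inject₁ i)) < column (cycleColumn (suc i))
  cycleColumn-step = λ where
    0F → column-monoʳ-< (# 0) (# 1) (# 0) (# 1) (s≤s z≤n)
    1F → column-monoˡ-< (# 0) (# 1) (# 1) (# 1) (# 1) (# 0) (s≤s z≤n)
    2F → column-monoʳ-< (# 1) (# 1) (# 0) (# 2) (s≤s z≤n)
    3F → column-monoᵐ-< (# 1) (# 1) (# 2) (# 2) (# 1) (s≤s (s≤s z≤n))
    4F → column-monoˡ-< (# 1) (# 2) (# 1) (# 2) (# 0) (# 1) (s≤s (s≤s z≤n))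
    5F → column-monoʳ-< (# 2) (# 0) (# 1) (# 2) (s≤s (s≤s z≤n))

  -- Both matrices are named so that comparing them never unfolds det of a symbolic matrix.
  cycleSubmatrix : Matrix 7 7
  cycleSubmatrix = submatrix (barycenterA m n) (row ∘ cycleRow) (column ∘ cycleColumn)

  det-cycleSubmatrix : det cycleSubmatrix ≡ + 2
  det-cycleSubmatrix = trans (det-cong {M = cycleSubmatrix} {N = cycleEntries} cycleSubmatrix≗) det-cycle
    where
    cycleSubmatrix≗ : ∀ a b → cycleSubmatrix a b ≡ cycleEntries a b
    cycleSubmatrix≗ a b = barycenterA-entry (cycleRow a) (cycleColumn b)

  ¬totallyUnimodular : ¬ TotallyUnimodular (barycenterA m n)
  ¬totallyUnimodular =
    det≡2⇒¬TotallyUnimodular (barycenterA m n) (row ∘ cycleRow) (column ∘ cycleColumn)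
      (adjacent<⇒strictlyIncreasing (row ∘ cycleRow) cycleRow-step)
      (adjacent<⇒strictlyIncreasing (column ∘ cycleColumn) cycleColumn-step)
      det-cycleSubmatrix

  ¬incidenceMatrix : ¬ IsIncidenceMatrix (barycenterA m n)
  ¬incidenceMatrix =
    twice-1⇒¬IsIncidenceMatrix (barycenterA m n) (column X₂[0,0]) (row G₁[0]) (row G₂[0])
      (<⇒≢ (row-monoˡ-< G₁[0] G₂[0] (↑ʳ-monoʳ-< m (s≤s z≤n))))
      (barycenterA-entry G₁[0] X₂[0,0]) (barycenterA-entry G₂[0] X₂[0,0])
    where
    X₂[0,0] : Column
    X₂[0,0] = # 1 , # 0 , # 0
    G₁[0] G₂[0] : Row
    G₁[0] = inj₂ (# 0 , # 0)
    G₂[0] = inj₂ (# 1 , # 0)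

theorem3p8 : (m n : ℕ) → 3 ≤ m → 3 ≤ n →
    ¬ IsIncidenceMatrix (barycenterA m n) × ¬ TotallyUnimodular (barycenterA m n)
theorem3p8 (suc (suc (suc m′))) (suc (suc (suc n′))) (s≤s (s≤s (s≤s _))) (s≤s (s≤s (s≤s _))) =
  ¬incidenceMatrix , ¬totallyUnimodular
  where open OddCycle m′ n′
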